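{- Let $B_n\subseteq\{0,1\}^n$ and let $S_n := \{k\in[n]\mid \{k\}\text{ is a part of } \mathbf{SP}(B_n)\}$. Let $A \subseteq B_n$ be arbitrary, let an injective mapping $p : A \to B_n$ be given, and let $\mathcal{Q}_A := \{\bigcap_{a\in A}\mathbf{SP}(a)(k) \mid k\in[n]\}$. Let $Q_p : [n] \to \mathcal{Q}_A$ be an assignment with $|Q_p^{ -1}(P)| = |P|$ for every $P\in\mathcal{Q}_A$ such that every $\pi \in \mathbf{Sym}_n$ realising a $\sigma \in \mathbf{Sym}(B_n)$ with $\sigma^{ -1}(a) = p(a)$ for all $a \in A$ satisfies $\pi(k)\in Q_p(k)$ for all $k\in[n]$ (such an assignment always exists). Then every $\pi \in \mathbf{Sym}_n$ that realises a $\sigma \in \mathbf{Sym}(B_n)$ with $\sigma^{ -1}(a) = p(a)$ for all $a \in A$ satisfies $\pi^{ -1}(P \cap S_n) = Q^{ -1}_p(P) \cap S_n$ for all $P \in \mathcal{Q}_A$.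
   Context: $\mathbf{Sym}_n$ acts on $\{0,1\}^n$ by permuting positions: $\pi(v) = v_{\pi^{ -1}(1)}\cdots v_{\pi^{ -1}(n)}$, and this extends to sets of strings. For $B\subseteq\{0,1\}^n$, $\mathbf{SP}(B)$ is the coarsest partition $\mathcal{P}$ of $[n]$ such that every $\pi\in\mathbf{Sym}_n$ fixing each part of $\mathcal{P}$ setwise stabilises $B$; for a single string $a$, $\mathbf{SP}(a)$ is the partition into the positions with $0$ and with $1$. $\mathcal{P}(k)$ is the part containing $k$. $\mathbf{Sym}(B_n)$ is the group of permutations of the strings in $B_n$; $\pi$ realises $\sigma$ if $\pi(b)=\sigma(b)$ for all $b\in B_n$. In the paper $B_n$ is the colour class $C$ of an ordered partition of $\{0,1\}^n$ maximising the number of parts of $\mathbf{SP}(C)$, but the statement holds for any $B_n$. -}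

module Defs where

open import Level using (0ℓ)
open import Data.Bool using (Bool; true; false; T)
open import Data.Bool.Properties using () renaming (_≟_ to _≟ᵇ_)
open import Data.Nat using (ℕ; zero; suc)
open import Data.Fin using (Fin)
open import Data.Fin.Permutation using (Permutation′; _⟨$⟩ʳ_; _⟨$⟩ˡ_)
open import Data.Vec using (Vec; []; _∷_; lookup; tabulate)
open import Data.List using (length; filter)
open import Data.List.Base using () renaming (allFin to allFinL)
open import Data.Product using (Σ; ∃; ∃-syntax; _×_; _,_)
open import Relation.Binary.PropositionalEquality using (_≡_)
open import Relation.Binary using (IsEquivalence)
open import Relation.Nullary using (Dec; yes; no; ¬_)
open import Relation.Nullary.Decidable using (T?; _→-dec_; map′)
open import Relation.Unary using (Pred; Decidable)
open import Function.Bundles using (_⇔_)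

Str : ℕ → Set
Str n = Vec Bool n

StrSet : ℕ → Set
StrSet n = Str n → Bool

_∈ₛ_ : ∀ {n} → Str n → StrSet n → Set
v ∈ₛ B = T (B v)

_⊆ₛ_ : ∀ {n} → StrSet n → StrSet n → Set
A ⊆ₛ B = ∀ a → a ∈ₛ A → a ∈ₛ B

act : ∀ {n} → Permutation′ n → Str n → Str n
act π v = tabulate (λ i → lookup v (π ⟨$⟩ˡ i))

_∈img[_]_ : ∀ {n} → Str n → Permutation′ n → StrSet n → Set
v ∈img[ π ] B = ∃[ b ] (b ∈ₛ B × act π b ≡ v)

Stabilises : ∀ {n} → Permutation′ n → StrSet n → Set
Stabilises π B = ∀ v → (v ∈img[ π ] B) ⇔ (v ∈ₛ B)

-- Partitions of [n] are represented by equivalence relations on Fin n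
-- (the parts are the equivalence classes; R j k means j ∈ 𝒫(k)).

Rel : ℕ → Set₁
Rel n = Fin n → Fin n → Set

FixesParts : ∀ {n} → Permutation′ n → Rel n → Set
FixesParts π R = ∀ k j → R j k ⇔ (∃[ i ] (R i k × π ⟨$⟩ʳ i ≡ j))

Admissible : ∀ {n} → StrSet n → Rel n → Set
Admissible B R = ∀ (π : Permutation′ _) → FixesParts π R → Stabilises π B

record IsSP {n} (B : StrSet n) (R : Rel n) : Set₁ where
  field
    isEquivalence : IsEquivalence R
    admissible    : Admissible B R
    coarsest      : ∀ (R′ : Rel n) → IsEquivalence R′ → Admissible B R′ →
                    ∀ i j → R′ i j → R i j

SingletonPart : ∀ {n} → Rel n → Fin n → Set
SingletonPart R k = ∀ j → R j k → j ≡ k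

SPₛ : ∀ {n} → Str n → Fin n → Fin n → Set
SPₛ a k i = lookup a i ≡ lookup a k

-- i ∈ ⋂_{a∈A} SP(a)(k) ; the elements of 𝒬_A are the sets Cls A k.
Cls : ∀ {n} → StrSet n → Fin n → Fin n → Set
Cls A k i = ∀ a → a ∈ₛ A → SPₛ a k i

-- Sym(B): permutations of the strings in B (values outside B irrelevant).
record SymB {n} (B : StrSet n) : Set where
  field
    σ     : Str n → Str n
    σ⁻¹   : Str n → Str n
    σ∈    : ∀ b → b ∈ₛ B → σ b ∈ₛ B
    σ⁻¹∈  : ∀ b → b ∈ₛ B → σ⁻¹ b ∈ₛ B
    invˡ  : ∀ b → b ∈ₛ B → σ⁻¹ (σ b) ≡ b
    invʳ  : ∀ b → b ∈ₛ B → σ (σ⁻¹ b) ≡ b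

Realises : ∀ {n} {B : StrSet n} → Permutation′ n → SymB B → Set
Realises {B = B} π s = ∀ b → b ∈ₛ B → act π b ≡ SymB.σ s b

card : ∀ {n} {P : Pred (Fin n) 0ℓ} → Decidable P → ℕ
card {n} P? = length (filter P? (allFinL n))

allStr? : ∀ {n} {P : Str n → Set} → (∀ v → Dec (P v)) → Dec (∀ v → P v)
allStr? {zero} P? with P? []
... | yes p = yes λ { [] → p }
... | no ¬p = no λ h → ¬p (h [])
allStr? {suc n} {P} P? with allStr? (λ v → P? (true ∷ v)) | allStr? (λ v → P? (false ∷ v))
... | yes t | yes f = yes λ { (true ∷ v) → t v ; (false ∷ v) → f v }
... | no ¬t | _ = no λ h → ¬t (λ v → h (true ∷ v))
... | yes _ | no ¬f = no λ h → ¬f (λ v → h (false ∷ v))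

Cls? : ∀ {n} (A : StrSet n) (k : Fin n) → Decidable (Cls A k)
Cls? A k i = allStr? (λ a → T? (A a) →-dec (lookup a i ≟ᵇ lookup a k))

{-# OPTIONS --safe #-}
-- A permutation realising some σ ∈ Sym(B) stabilises B.  Conjugating by a
-- stabiliser τ of B turns the partitions admissible for B into admissible
-- ones, so the pull-back of SP(B) along τ is admissible, hence, SP(B) being
-- coarsest, finer than SP(B): τ maps SP(B) onto itself and permutes its
-- singleton parts.  The 𝒬_A-half of the claim is immediate from the
-- hypothesis π(k) ∈ Q_p(k).
module Submission where

open import Defs
open import Data.Nat using (ℕ)
open import Data.Fin using (Fin)
open import Data.Fin.Permutation
  using (Permutation′; _⟨$⟩ʳ_; _⟨$⟩ˡ_; id; flip; _∘ₚ_; _≈_; inverseˡ; inverseʳ)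
open import Data.Product using (_×_; _,_; ∃-syntax)
open import Data.Product.Function.NonDependent.Propositional using (_×-⇔_)
open import Data.Vec using (tabulate; lookup)
open import Data.Vec.Properties using (lookup∘tabulate; tabulate-cong; tabulate∘lookup)
open import Function.Base using (_on_)
open import Function.Bundles using (_⇔_; mk⇔; Equivalence)
open import Relation.Binary.Construct.On using () renaming (isEquivalence to on-isEquivalence)
open import Relation.Binary.PropositionalEquality
  using (_≡_; refl; sym; trans; cong; subst; subst₂; module ≡-Reasoning)

open Equivalence using (to; from)

private
  variable
    n : ℕ
    B : StrSet n
    R : Rel n

act-∘ₚ : (π ρ : Permutation′ n) (v : Str n) → act (π ∘ₚ ρ) v ≡ act ρ (act π v)
act-∘ₚ π ρ v = tabulate-cong (λ i → sym (lookup∘tabulate _ (ρ ⟨$⟩ˡ i)))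

act-cong : (π ρ : Permutation′ n) → flip π ≈ flip ρ → (v : Str n) → act π v ≡ act ρ v
act-cong π ρ π≈ρ v = tabulate-cong (λ i → cong (lookup v) (π≈ρ i))

act-flip-act : (π : Permutation′ n) (v : Str n) → act (flip π) (act π v) ≡ v
act-flip-act π v = begin
  act (flip π) (act π v)  ≡⟨ act-∘ₚ π (flip π) v ⟨
  act (π ∘ₚ flip π) v     ≡⟨ act-cong (π ∘ₚ flip π) id (λ _ → inverseˡ π) v ⟩
  tabulate (lookup v)     ≡⟨ tabulate∘lookup v ⟩
  v                       ∎
  where open ≡-Reasoning

Stabilises-∘ₚ : (π ρ : Permutation′ n) →
                Stabilises π B → Stabilises ρ B → Stabilises (π ∘ₚ ρ) B
Stabilises-∘ₚ {B = B} π ρ πB ρB v = mk⇔ into onto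
  where
  into : v ∈img[ π ∘ₚ ρ ] B → v ∈ₛ B
  into (b , b∈B , πρb≡v) =
    subst (_∈ₛ B) (trans (sym (act-∘ₚ π ρ b)) πρb≡v)
      (to (ρB _) (act π b , to (πB _) (b , b∈B , refl) , refl))
  onto : v ∈ₛ B → v ∈img[ π ∘ₚ ρ ] B
  onto v∈B with from (ρB v) v∈B
  ... | c , c∈B , ρc≡v with from (πB c) c∈B
  ... | b , b∈B , πb≡c = b , b∈B , trans (act-∘ₚ π ρ b) (trans (cong (act ρ) πb≡c) ρc≡v)

Stabilises-cong : (π ρ : Permutation′ n) → flip π ≈ flip ρ →
                  Stabilises π B → Stabilises ρ B
Stabilises-cong π ρ π≈ρ πB v = mk⇔
  (λ (b , b∈B , ρb≡v) → to (πB v) (b , b∈B , trans (act-cong π ρ π≈ρ b) ρb≡v))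
  (λ v∈B → let (b , b∈B , πb≡v) = from (πB v) v∈B
           in b , b∈B , trans (sym (act-cong π ρ π≈ρ b)) πb≡v)

Stabilises-flip : (π : Permutation′ n) → Stabilises π B → Stabilises (flip π) B
Stabilises-flip {B = B} π πB v = mk⇔ into onto
  where
  into : v ∈img[ flip π ] B → v ∈ₛ B
  into (b , b∈B , π⁻¹b≡v) with from (πB b) b∈B
  ... | c , c∈B , πc≡b =
    subst (_∈ₛ B) (trans (sym (act-flip-act π c)) (trans (cong (act (flip π)) πc≡b) π⁻¹b≡v)) c∈B
  onto : v ∈ₛ B → v ∈img[ flip π ] B
  onto v∈B = act π v , to (πB _) (v , v∈B , refl) , act-flip-act π v

Realises⇒Stabilises : (π : Permutation′ n) (s : SymB B) → Realises π s → Stabilises π B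
Realises⇒Stabilises {B = B} π s πσ v = mk⇔ into onto
  where
  open SymB s
  into : v ∈img[ π ] B → v ∈ₛ B
  into (b , b∈B , πb≡v) = subst (_∈ₛ B) (trans (sym (πσ b b∈B)) πb≡v) (σ∈ b b∈B)
  onto : v ∈ₛ B → v ∈img[ π ] B
  onto v∈B = σ⁻¹ v , σ⁻¹∈ v v∈B , trans (πσ _ (σ⁻¹∈ v v∈B)) (invʳ v v∈B)

FixesParts-conj : (τ ρ : Permutation′ n) →
                  FixesParts ρ (R on (τ ⟨$⟩ʳ_)) → FixesParts (flip τ ∘ₚ ρ ∘ₚ τ) R
FixesParts-conj {R = R} τ ρ ρR k j = mk⇔ into onto
  where
  ττ⁻¹ : ∀ {x y} → R x y → R (τ ⟨$⟩ʳ (τ ⟨$⟩ˡ x)) (τ ⟨$⟩ʳ (τ ⟨$⟩ˡ y))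
  ττ⁻¹ = subst₂ R (sym (inverseʳ τ)) (sym (inverseʳ τ))
  into : R j k → ∃[ i ] (R i k × τ ⟨$⟩ʳ (ρ ⟨$⟩ʳ (τ ⟨$⟩ˡ i)) ≡ j)
  into jk with to (ρR (τ ⟨$⟩ˡ k) (τ ⟨$⟩ˡ j)) (ττ⁻¹ jk)
  ... | i , ik , ρi≡τ⁻¹j =
    τ ⟨$⟩ʳ i , subst (R (τ ⟨$⟩ʳ i)) (inverseʳ τ) ik ,
    trans (cong (λ x → τ ⟨$⟩ʳ (ρ ⟨$⟩ʳ x)) (inverseˡ τ))
          (trans (cong (τ ⟨$⟩ʳ_) ρi≡τ⁻¹j) (inverseʳ τ))
  onto : ∃[ i ] (R i k × τ ⟨$⟩ʳ (ρ ⟨$⟩ʳ (τ ⟨$⟩ˡ i)) ≡ j) → R j k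
  onto (i , ik , τρτ⁻¹i≡j) =
    subst₂ R (inverseʳ τ) (inverseʳ τ)
      (from (ρR (τ ⟨$⟩ˡ k) (τ ⟨$⟩ˡ j))
        (τ ⟨$⟩ˡ i , ττ⁻¹ ik , trans (sym (inverseˡ τ)) (cong (τ ⟨$⟩ˡ_) τρτ⁻¹i≡j)))

Admissible-on : (τ : Permutation′ n) → Stabilises τ B →
                Admissible B R → Admissible B (R on (τ ⟨$⟩ʳ_))
Admissible-on τ τB adm ρ ρR =
  Stabilises-cong (τ ∘ₚ ρ′ ∘ₚ flip τ) ρ (λ _ → trans (inverseˡ τ) (cong (ρ ⟨$⟩ˡ_) (inverseˡ τ)))
    (Stabilises-∘ₚ τ (ρ′ ∘ₚ flip τ) τB
      (Stabilises-∘ₚ ρ′ (flip τ) (adm ρ′ (FixesParts-conj τ ρ ρR)) (Stabilises-flip τ τB)))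
  where
  ρ′ : Permutation′ _
  ρ′ = flip τ ∘ₚ ρ ∘ₚ τ

Stabilises⇒reflects-SP : IsSP B R → (τ : Permutation′ n) → Stabilises τ B →
                         ∀ x y → R (τ ⟨$⟩ʳ x) (τ ⟨$⟩ʳ y) → R x y
Stabilises⇒reflects-SP {R = R} sp τ τB =
  coarsest (R on (τ ⟨$⟩ʳ_)) (on-isEquivalence _ isEquivalence) (Admissible-on τ τB admissible)
  where open IsSP sp

Stabilises⇒preserves-SingletonPart : IsSP B R → (τ : Permutation′ n) → Stabilises τ B →
                                     ∀ i → SingletonPart R i → SingletonPart R (τ ⟨$⟩ʳ i)
Stabilises⇒preserves-SingletonPart {R = R} sp τ τB i ｛i｝ j jτi =
  trans (sym (inverseʳ τ))
    (cong (τ ⟨$⟩ʳ_) (｛i｝ (τ ⟨$⟩ˡ j)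
      (Stabilises⇒reflects-SP sp τ τB _ i (subst (λ x → R x (τ ⟨$⟩ʳ i)) (sym (inverseʳ τ)) jτi))))

Stabilises⇒SingletonPart⇔ : IsSP B R → (τ : Permutation′ n) → Stabilises τ B →
                            ∀ i → SingletonPart R (τ ⟨$⟩ʳ i) ⇔ SingletonPart R i
Stabilises⇒SingletonPart⇔ {R = R} sp τ τB i = mk⇔
  (λ ｛τi｝ → subst (SingletonPart R) (inverseˡ τ)
               (Stabilises⇒preserves-SingletonPart sp (flip τ) (Stabilises-flip τ τB) _ ｛τi｝))
  (Stabilises⇒preserves-SingletonPart sp τ τB i)

Cls-cong : (A : StrSet n) {i k : Fin n} → Cls A k i → ∀ j → Cls A j i ⇔ Cls A j k
Cls-cong A i∈k j = mk⇔ (λ i∈j a a∈A → trans (sym (i∈k a a∈A)) (i∈j a a∈A))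
                       (λ k∈j a a∈A → trans (i∈k a a∈A) (k∈j a a∈A))

corollary27 : (n : ℕ) (B : StrSet n) (R : Rel n) → IsSP B R →
    (A : StrSet n) → A ⊆ₛ B →
    (p : Str n → Str n) → (∀ a → a ∈ₛ A → p a ∈ₛ B) →
    (∀ a a′ → a ∈ₛ A → a′ ∈ₛ A → p a ≡ p a′ → a ≡ a′) →
    (Qp : Fin n → Fin n) →
    (∀ j → card (λ k → Cls? A j (Qp k)) ≡ card (Cls? A j)) →
    (∀ (π : Permutation′ n) (s : SymB B) → Realises π s →
       (∀ a → a ∈ₛ A → SymB.σ⁻¹ s a ≡ p a) →
       ∀ k → Cls A (Qp k) (π ⟨$⟩ʳ k)) →
    ∀ (π : Permutation′ n) (s : SymB B) → Realises π s →
      (∀ a → a ∈ₛ A → SymB.σ⁻¹ s a ≡ p a) →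
      ∀ j i → (Cls A j (π ⟨$⟩ʳ i) × SingletonPart R (π ⟨$⟩ʳ i))
              ⇔ (Cls A j (Qp i) × SingletonPart R i)
corollary27 n B R sp A _ p _ _ Qp _ πk∈Qpk π s πσ σ⁻¹≡p j i =
  Cls-cong A (πk∈Qpk π s πσ σ⁻¹≡p i) j
    ×-⇔ Stabilises⇒SingletonPart⇔ sp π (Realises⇒Stabilises π s πσ) i
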